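{- Let $(\Sigma,\to,\ell)$ be a Kripke structure and let $\mathcal{P}=\langle P,\trianglelefteq\rangle$ be a partial order PR (i.e. $\trianglelefteq$ is a partial order on the blocks of the partition $P$ of $\Sigma$). Then $\mathcal{P}$ has a partition refiner if and only if there exist $B,C\in P$ such that: (i) $B\to^{\exists}C$; (ii) for every $C'\in P$ with $C\trianglelefteq C'$ and $C\neq C'$, it is not the case that $B\to^{\exists}C'$; (iii) $B\not\subseteq\mathrm{pre}(C)$.
   Context: $\mathrm{pre}(T)=\{s\in\Sigma\mid \exists t\in T.\ s\to t\}$. For $S_1,S_2\subseteq\Sigma$, $S_1\to^{\exists}S_2$ means there exist $s_1\in S_1,s_2\in S_2$ with $s_1\to s_2$. $P(s)$ is the block of $P$ containing $s$, and $\mu_{\mathcal{P}}(X)=\bigcup\{C\in P\mid \exists s\in X.\ P(s)\trianglelefteq C\}$ for $X\subseteq\Sigma$. A block $C\in P$ is a partition refiner of $\mathcal{P}$ if there exists $B\in P$ with $B\cap\mathrm{pre}(\mu_{\mathcal{P}}(C))\neq\varnothing$ and $B\setminus\mathrm{pre}(\mu_{\mathcal{P}}(C))\neq\varnothing$. -}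

module Defs where

open import Level using (0ℓ)
open import Data.Nat using (ℕ)
open import Data.Fin using (Fin)
open import Data.Product using (Σ; ∃; ∃-syntax; _×_; _,_)
open import Relation.Nullary using (¬_)
open import Relation.Unary using (Pred; _⊆_; _∈_)
open import Relation.Binary using (Rel; Decidable)
open import Relation.Binary.Structures using (IsDecPartialOrder)
open import Relation.Binary.PropositionalEquality using (_≡_)
open import Function using (Surjective)

record Kripke (L : Set) : Set₁ where
  field
    n       : ℕ
    _⟶_     : Rel (Fin n) 0ℓ
    _⟶?_    : Decidable _⟶_
    ℓ       : Fin n → L

-- A partial order PR ⟨P, ⊴⟩ over a state space Fin n:
-- the partition P has m blocks, indexed by Fin m; blk s is the block P(s)
-- containing s; blk is surjective (blocks are nonempty);
-- ⊴ is a (decidable) partial order on the blocks.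
record PartitionRel (n : ℕ) : Set₁ where
  field
    m        : ℕ
    blk      : Fin n → Fin m
    blk-surj : Surjective _≡_ _≡_ blk
    _⊴_      : Rel (Fin m) 0ℓ
    isPO     : IsDecPartialOrder _≡_ _⊴_

module _ {L : Set} (K : Kripke L) where
  open Kripke K

  pre : Pred (Fin n) 0ℓ → Pred (Fin n) 0ℓ
  pre T s = ∃[ t ] (t ∈ T × s ⟶ t)

  module _ (𝒫 : PartitionRel n) where
    open PartitionRel 𝒫

    block : Fin m → Pred (Fin n) 0ℓ
    block B s = blk s ≡ B

    _→∃_ : Pred (Fin n) 0ℓ → Pred (Fin n) 0ℓ → Set
    S₁ →∃ S₂ = ∃[ s₁ ] ∃[ s₂ ] (s₁ ∈ S₁ × s₂ ∈ S₂ × s₁ ⟶ s₂)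

    μ : Pred (Fin n) 0ℓ → Pred (Fin n) 0ℓ
    μ X t = ∃[ s ] (s ∈ X × blk s ⊴ blk t)

    IsPartitionRefiner : Fin m → Set
    IsPartitionRefiner C =
      ∃[ B ] ( (∃[ s ] (s ∈ block B × s ∈ pre (μ (block C))))
             × (∃[ s ] (s ∈ block B × ¬ (s ∈ pre (μ (block C))))) )

    HasPartitionRefiner : Set
    HasPartitionRefiner = ∃[ C ] IsPartitionRefiner C

module Submission where

-- The key observation concerns a block C that is ⊴-maximal among the
-- blocks reachable from a block B (condition (ii)): for states of B,
-- being in pre(μ(C)) is then the same as being in pre(C), because any
-- transition from B into μ(C) must land in a block above C that B
-- reaches, which by maximality is C itself.
--
--  (⇐) If B, C satisfy (i)–(iii), then some state of B is in pre(C)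
--      ⊆ pre(μ(C)) by (i), and some state of B is outside pre(C) by (iii),
--      hence outside pre(μ(C)) by the key observation: C refines via B.
--  (⇒) If C refines via B, a state of B reaches some block D above C.
--      In a finite poset there is a maximal D* above D that B reaches;
--      it satisfies (i), (ii), and (iii) because pre(D*) ⊆ pre(μ(C))
--      while some state of B lies outside pre(μ(C)).

open import Defs
open import Level using (0ℓ)
open import Data.Nat using (ℕ)
open import Data.Fin using (Fin; _≟_)
open import Data.Fin.Properties using (any?)
open import Data.Fin.Induction using (po-noetherian)
open import Data.Product using (∃-syntax; _×_; _,_)
open import Relation.Nullary using (¬_; yes; no)
open import Relation.Nullary.Decidable using (_×-dec_; ¬?; decidable-stable)
open import Relation.Unary using (Pred; _⊆_; _∈_)
import Relation.Unary as Unary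
open import Relation.Binary using (Rel)
open import Relation.Binary.PropositionalEquality using (_≡_; refl; sym; subst)
open import Relation.Binary.Structures using (IsDecPartialOrder)
open import Induction.WellFounded using (Acc; acc)
open import Function.Bundles using (_⇔_; mk⇔)
open import Data.Empty using (⊥-elim)

-- A failed inclusion between decidable predicates on a finite type has an
-- explicit counterexample (constructively, ¬ (P ⊆ Q) alone gives none).
counterexample : ∀ {n} {P Q : Pred (Fin n) 0ℓ} →
                 Unary.Decidable P → Unary.Decidable Q →
                 ¬ (P ⊆ Q) → ∃[ s ] (P s × ¬ Q s)
counterexample P? Q? P⊈Q with any? (λ s → P? s ×-dec ¬? (Q? s))
... | yes found = found
... | no none   = ⊥-elim (P⊈Q λ {s} Ps →
                    decidable-stable (Q? s) (λ ¬Qs → none (s , Ps , ¬Qs)))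

module FiniteMaximal {m : ℕ} {_≤_ : Rel (Fin m) 0ℓ}
                     (po : IsDecPartialOrder _≡_ _≤_)
                     {Q : Pred (Fin m) 0ℓ} (Q? : Unary.Decidable Q) where
  open IsDecPartialOrder po using (isPartialOrder; _≤?_) renaming (refl to ≤-refl; trans to ≤-trans)

  IsMaximal : Fin m → Set
  IsMaximal y = ∀ z → y ≤ z → ¬ (y ≡ z) → ¬ Q z

  -- Climb strictly upwards while possible; finiteness makes ≤ noetherian.
  climb : ∀ {x} y → Acc (λ z y → y ≤ z × ¬ (y ≡ z)) y → x ≤ y → Q y →
          ∃[ y* ] (x ≤ y* × Q y* × IsMaximal y*)
  climb y (acc above) x≤y Qy
    with any? (λ z → (y ≤? z) ×-dec (¬? (y ≟ z) ×-dec Q? z))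
  ... | yes (z , y≤z , y≢z , Qz) = climb z (above (y≤z , y≢z)) (≤-trans x≤y y≤z) Qz
  ... | no none = y , x≤y , Qy , λ z y≤z y≢z Qz → none (z , y≤z , y≢z , Qz)

  maximal-above : ∀ {x} → Q x → ∃[ y ] (x ≤ y × Q y × IsMaximal y)
  maximal-above {x} Qx =
    climb x (po-noetherian isPartialOrder x) ≤-refl Qx

module Refiners {L : Set} (K : Kripke L) (𝒫 : PartitionRel (Kripke.n K)) where
  open Kripke K
  open PartitionRel 𝒫
  open IsDecPartialOrder isPO using () renaming (refl to ⊴-refl; trans to ⊴-trans)

  Block : Fin m → Pred (Fin n) 0ℓ
  Block = block K 𝒫

  Reaches : Fin m → Fin m → Set
  Reaches B C = _→∃_ K 𝒫 (Block B) (Block C)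

  MaximalTarget : Fin m → Fin m → Set
  MaximalTarget B C = ∀ C′ → C ⊴ C′ → ¬ (C ≡ C′) → ¬ Reaches B C′

  -- Finiteness makes reachability between blocks and membership in
  -- pre(C) decidable; this is what lets us find maximal targets and
  -- explicit counterexamples to (iii).
  reaches? : ∀ B → Unary.Decidable (Reaches B)
  reaches? B C = any? λ s → any? λ t →
    (blk s ≟ B) ×-dec ((blk t ≟ C) ×-dec (s ⟶? t))

  pre-block? : ∀ C → Unary.Decidable (pre K (Block C))
  pre-block? C s = any? λ t → (blk t ≟ C) ×-dec (s ⟶? t)

  pre-mono : ∀ {T T′ : Pred (Fin n) 0ℓ} → T ⊆ T′ → pre K T ⊆ pre K T′
  pre-mono T⊆T′ (t , t∈T , s⟶t) = t , T⊆T′ t∈T , s⟶t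

  above⊆μ : ∀ {C D} → C ⊴ D → Block D ⊆ μ K 𝒫 (Block C)
  above⊆μ {C} C⊴D {t} t∈D with blk-surj C
  ... | u , blk⁻¹ = u , u∈C , subst (_⊴ blk t) (sym u∈C) (subst (C ⊴_) (sym t∈D) C⊴D)
    where u∈C = blk⁻¹ refl

  -- The key observation: from a block B, transitions into μ(C) only reach
  -- C itself when C is a maximal target of B.
  maximal⇒pre-μ⊆pre : ∀ {B C} → MaximalTarget B C →
                      ∀ {s} → s ∈ Block B → s ∈ pre K (μ K 𝒫 (Block C)) → s ∈ pre K (Block C)
  maximal⇒pre-μ⊆pre {B} {C} maximal {s} s∈B (t , (u , u∈C , u⊴t) , s⟶t) with C ≟ blk t
  ... | yes C≡t = t , sym C≡t , s⟶t
  ... | no  C≢t = ⊥-elim (maximal (blk t) (subst (_⊴ blk t) u∈C u⊴t) C≢t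
                                  (s , t , s∈B , refl , s⟶t))

  Witness : Set
  Witness = ∃[ B ] ∃[ C ] (Reaches B C × MaximalTarget B C × ¬ (Block B ⊆ pre K (Block C)))

  -- (⇒): push the target block of B's transition up to a maximal one.
  refiner⇒witness : HasPartitionRefiner K 𝒫 → Witness
  refiner⇒witness (C , B , (s , s∈B , t , (u , u∈C , u⊴t) , s⟶t) , (s′ , s′∈B , s′∉preμC))
    with FiniteMaximal.maximal-above isPO (reaches? B) {blk t} (s , t , s∈B , refl , s⟶t)
  ... | D , t⊴D , B→D , maximal =
    B , D , B→D , maximal , λ B⊆preD → s′∉preμC (pre-mono (above⊆μ C⊴D) (B⊆preD s′∈B))
    where C⊴D = ⊴-trans (subst (_⊴ blk t) u∈C u⊴t) t⊴D

  -- (⇐): C refines via B, split by a state of B outside pre(C).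
  witness⇒refiner : Witness → HasPartitionRefiner K 𝒫
  witness⇒refiner (B , C , (s , t , s∈B , t∈C , s⟶t) , maximal , B⊈preC)
    with counterexample (λ s → blk s ≟ B) (pre-block? C) B⊈preC
  ... | s′ , s′∈B , s′∉preC =
    C , B , (s , s∈B , pre-mono (above⊆μ ⊴-refl) (t , t∈C , s⟶t))
          , (s′ , s′∈B , λ s′∈preμC → s′∉preC (maximal⇒pre-μ⊆pre maximal s′∈B s′∈preμC))

theorem4 : {L : Set} (K : Kripke L) (𝒫 : PartitionRel (Kripke.n K)) →
    HasPartitionRefiner K 𝒫
      ⇔ (∃[ B ] ∃[ C ]
           ( _→∃_ K 𝒫 (block K 𝒫 B) (block K 𝒫 C)
           × (∀ C′ → PartitionRel._⊴_ 𝒫 C C′ → ¬ (C ≡ C′)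
                   → ¬ (_→∃_ K 𝒫 (block K 𝒫 B) (block K 𝒫 C′)))
           × ¬ (block K 𝒫 B ⊆ pre K (block K 𝒫 C)) ))
theorem4 K 𝒫 = mk⇔ refiner⇒witness witness⇒refiner
  where open Refiners K 𝒫
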